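{- Let $G$ be an $s$-$t$-DAG with flow $f$, and let $C_1$ and $C_2$ be any two top-cuts of $G$ with $|C_1|\ge|C_2|$. For a set of arcs $S$ let $\mathcal{F}(S)$ denote the multiset of flow values $\{f(a):a\in S\}$, and set $F_1=\mathcal{F}(C_1)\setminus\mathcal{F}(C_2)$ and $F_2=\mathcal{F}(C_2)\setminus\mathcal{F}(C_1)$ (multiset differences). If $(G,f)$ has a flow decomposition of size $k$, then $$k\ \ge\ |\mathcal{F}(C_1)\cap\mathcal{F}(C_2)|+\tfrac{2}{3}(|F_1|+|F_2|),$$ and this lower bound is strictly larger than $|C_1|$ if and only if $|F_1|<2|F_2|$.
   Context: An $s$-$t$-DAG is a directed acyclic (multi)graph $G=(V,A)$ with a unique source $s$ and unique sink $t$. A flow $f$ assigns a positive integer to every arc with inflow equal to outflow at every vertex other than $s,t$. A flow decomposition of size $k$ is a set of $s$-$t$-paths $p_1,\dots,p_k$ with weights $w_1,\dots,w_k$ such that $f(a)=\sum_i w_i\mathbf{1}_{p_i}(a)$ for every arc $a$. Fix a topological ordering $v_1=s,\dots,v_n=t$ of $G$ and let $S_i=\{v_j:j\le i\}$; the top-cuts are the arc sets $A^+(S_i)$ of arcs with tail in $S_i$ and head outside $S_i$. Multiset intersection and difference take multiplicities into account, and $|\cdot|$ counts with multiplicity. -}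

module Defs where

open import Data.Nat using (ℕ; zero; suc; _+_; _*_; _≤_; _<_; _≤?_; _<?_; _≟_)
open import Data.Fin using (Fin; toℕ; fromℕ) renaming (zero to fzero)
import Data.Fin as Fin
open import Data.List using (List; []; _∷_; map; filter; allFin; length; tabulate)
open import Data.Nat.ListAction using (sum)
open import Data.Product using (Σ; ∃; _×_; _,_)
open import Data.Bool using (if_then_else_)
open import Relation.Nullary using (¬_; ⌊_⌋)
open import Relation.Nullary.Decidable using (_×-dec_)
open import Relation.Binary.PropositionalEquality using (_≡_)

-- Vertices are identified with their position in the fixed
-- topological ordering v₁ = s, …, vₙ = t: the vertex set is
-- Fin (suc (suc n)) (so at least the two vertices s ≠ t), s is index 0,
-- t is the last index, and every arc goes from a smaller to a larger
-- index (this is exactly "the ordering is topological", and implies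
-- acyclicity).

record STDAG : Set where
  field
    n     : ℕ
    m     : ℕ
    tl    : Fin m → Fin (suc (suc n))
    hd    : Fin m → Fin (suc (suc n))
    topo  : ∀ a → toℕ (tl a) < toℕ (hd a)

  Vertex : Set
  Vertex = Fin (suc (suc n))

  s : Vertex
  s = fzero

  t : Vertex
  t = fromℕ (suc n)

  field
    uniqueSource : ∀ v → ¬ (v ≡ s) → ∃ λ a → hd a ≡ v
    uniqueSink   : ∀ v → ¬ (v ≡ t) → ∃ λ a → tl a ≡ v

module _ (G : STDAG) where
  open STDAG G

  inSum : (Fin m → ℕ) → Vertex → ℕ
  inSum g v = sum (tabulate {n = m} λ a → if ⌊ hd a Fin.≟ v ⌋ then g a else 0)

  outSum : (Fin m → ℕ) → Vertex → ℕ
  outSum g v = sum (tabulate {n = m} λ a → if ⌊ tl a Fin.≟ v ⌋ then g a else 0)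

  record IsFlow (f : Fin m → ℕ) : Set where
    field
      positive     : ∀ a → 0 < f a
      conservation : ∀ v → ¬ (v ≡ s) → ¬ (v ≡ t) → inSum f v ≡ outSum f v

  data Walk : Vertex → Vertex → Set where
    nil  : ∀ {v} → Walk v v
    cons : ∀ {v} (a : Fin m) → Walk (hd a) v → Walk (tl a) v

  uses : ∀ {u v} → Fin m → Walk u v → ℕ
  uses a nil = 0
  uses a (cons b p) = (if ⌊ a Fin.≟ b ⌋ then 1 else 0) + uses a p

  STPath : Set
  STPath = Walk s t

  record FlowDecomposition (f : Fin m → ℕ) (k : ℕ) : Set where
    field
      path   : Fin k → STPath
      weight : Fin k → ℕ
      weight-positive : ∀ i → 0 < weight i
      decomposes : ∀ a → f a ≡ sum (tabulate {n = k} λ i → weight i * uses a (path i))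

  -- top-cut A⁺(S_i) for S_i = {v_j : j ≤ i}, i ranging over all vertices
  topCut : Vertex → List (Fin m)
  topCut i = filter (λ a → (toℕ (tl a) ≤? toℕ i) ×-dec (toℕ i <? toℕ (hd a))) (allFin m)

  flowValues : (Fin m → ℕ) → List (Fin m) → List ℕ
  flowValues f S = map f S

-- Finite multisets of naturals as lists (order irrelevant); multiset
-- intersection and difference respecting multiplicities.

removeOne : ℕ → List ℕ → List ℕ
removeOne x [] = []
removeOne x (y ∷ ys) = if ⌊ x ≟ y ⌋ then ys else y ∷ removeOne x ys

elem : ℕ → List ℕ → Data.Bool.Bool
elem x [] = Data.Bool.false
elem x (y ∷ ys) = if ⌊ x ≟ y ⌋ then Data.Bool.true else elem x ys

_∖ₘ_ : List ℕ → List ℕ → List ℕ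
xs ∖ₘ [] = xs
xs ∖ₘ (y ∷ ys) = removeOne y xs ∖ₘ ys

_∩ₘ_ : List ℕ → List ℕ → List ℕ
[] ∩ₘ ys = []
(x ∷ xs) ∩ₘ ys = if elem x ys then x ∷ (xs ∩ₘ removeOne x ys) else xs ∩ₘ ys

-- A top-cut is crossed at most once by every s-t-path, and each of its arcs lies on at
-- least one path of the decomposition; call an arc single if it lies on exactly one.
-- Counting path–arc incidences in a cut C gives 2|C| ≤ k + #{paths crossing C at a
-- single arc}.  Adding this for C₁ and C₂, a path is counted twice on the right only if
-- it crosses both cuts at single arcs, and then its weight is the flow value of both
-- arcs; grouping such paths by weight shows there are at most I = |𝓕(C₁) ∩ 𝓕(C₂)| of
-- them.  Hence 2|C₁| + 2|C₂| ≤ 3k + I, and |Cᵢ| = I + |Fᵢ| turns this into the bound.  The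
-- equivalence is arithmetic in I, |F₁|, |F₂| once |C₁| = I + |F₁|.
module Submission where

open import Data.Bool using (true; false; if_then_else_)
open import Data.Fin using (Fin; toℕ; zero; suc)
import Data.Fin as Fin
import Data.Fin.Properties as Fin
open import Data.List using (List; []; _∷_; map; filter; tabulate; allFin; length)
open import Data.List.Properties using (length-map; map-∘; map-tabulate)
open import Data.List.Relation.Unary.All using (All; []; _∷_; universal)
open import Data.List.Relation.Unary.All.Properties using (map⁺)
open import Data.Nat using (ℕ; zero; suc; _+_; _*_; _∸_; _⊓_; _≤_; _<_; _≟_; _≤?_; _<?_; z≤n; s≤s)
open import Data.Nat.ListAction using () renaming (sum to sumₗ)
open import Data.Nat.Properties
open import Algebra.Properties.Semiring.Sum +-*-semiring
  using (sum-syntax; sum-cong-≗; sum-remove; sum-replicate-zero; ∑-distrib-+; ∑-comm; *-distribˡ-sum; *-distribʳ-sum)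
open import Data.Nat.Tactic.RingSolver using (solve-∀)
open import Data.Product using (_×_; _,_; ∃)
open import Function using (_∘_; case_of_)
open import Function.Bundles using (_⇔_; mk⇔)
open import Relation.Nullary using (Dec; yes; no; ⌊_⌋; ¬_)
open import Relation.Nullary.Decidable using (_×-dec_)
open import Relation.Unary using (Decidable)
open import Relation.Binary.PropositionalEquality
open ≤-Reasoning

open import Defs

-- Stated with ⌊_⌋ to match Defs; ⌊_⌋ does not compute through map′, so e.g.
-- 𝟙[ suc i ≟ suc j ] and 𝟙[ i ≟ j ] are only propositionally equal (see 𝟙-cong).
𝟙[_] : ∀ {p} {P : Set p} → Dec P → ℕ
𝟙[ d ] = if ⌊ d ⌋ then 1 else 0

𝟙≤1 : ∀ {p} {P : Set p} (d : Dec P) → 𝟙[ d ] ≤ 1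
𝟙≤1 (yes _) = s≤s z≤n
𝟙≤1 (no _)  = z≤n

𝟙-no : ∀ {p} {P : Set p} (d : Dec P) → ¬ P → 𝟙[ d ] ≡ 0
𝟙-no (yes p) ¬p = case ¬p p of λ ()
𝟙-no (no _)  _  = refl

𝟙-cong : ∀ {p q} {P : Set p} {Q : Set q} (d : Dec P) (e : Dec Q) → (P → Q) → (Q → P) → 𝟙[ d ] ≡ 𝟙[ e ]
𝟙-cong (yes _) (yes _) _   _   = refl
𝟙-cong (yes p) (no ¬q) P→Q _   = case ¬q (P→Q p) of λ ()
𝟙-cong (no ¬p) (yes q) _   Q→P = case ¬p (Q→P q) of λ ()
𝟙-cong (no _)  (no _)  _   _   = refl

*-monoʳ-≤1 : ∀ m {n} → n ≤ 1 → m * n ≤ m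
*-monoʳ-≤1 m {n} n≤1 = ≤-trans (*-monoʳ-≤ m n≤1) (≤-reflexive (*-identityʳ m))

*-monoˡ-≤1 : ∀ {m} n → m ≤ 1 → m * n ≤ n
*-monoˡ-≤1 {m} n m≤1 = ≤-trans (*-monoˡ-≤ n m≤1) (≤-reflexive (*-identityˡ n))

m+n≤1+m*n : ∀ {m n} → m ≤ 1 → n ≤ 1 → m + n ≤ 1 + m * n
m+n≤1+m*n {zero}        {n}           _ n≤1 = n≤1
m+n≤1+m*n {suc zero}    {zero}        _ _   = ≤-refl
m+n≤1+m*n {suc zero}    {suc zero}    _ _   = ≤-refl
m+n≤1+m*n {suc zero}    {suc (suc _)} _ (s≤s ())
m+n≤1+m*n {suc (suc _)} {_}           (s≤s ()) _

-- Finite sums of naturals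

∑-mono-≤ : ∀ {n} {g h : Fin n → ℕ} → (∀ i → g i ≤ h i) → ∑[ i < n ] g i ≤ ∑[ i < n ] h i
∑-mono-≤ {zero}  _   = z≤n
∑-mono-≤ {suc n} g≤h = +-mono-≤ (g≤h zero) (∑-mono-≤ (g≤h ∘ suc))

∑≤card : ∀ {n} (g : Fin n → ℕ) → (∀ i → g i ≤ 1) → ∑[ i < n ] g i ≤ n
∑≤card {zero}  _ _   = z≤n
∑≤card {suc n} g g≤1 = +-mono-≤ (g≤1 zero) (∑≤card (g ∘ suc) (g≤1 ∘ suc))

≤-∑ : ∀ {n} (g : Fin n → ℕ) i → g i ≤ ∑[ j < n ] g j
≤-∑ {suc n} g i = ≤-trans (m≤m+n (g i) _) (≤-reflexive (sym (sum-remove {i = i} g)))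

∑≡0⇒≡0 : ∀ {n} (g : Fin n → ℕ) → ∑[ i < n ] g i ≡ 0 → ∀ i → g i ≡ 0
∑≡0⇒≡0 g ∑≡0 zero    = m+n≡0⇒m≡0 (g zero) ∑≡0
∑≡0⇒≡0 g ∑≡0 (suc i) = ∑≡0⇒≡0 (g ∘ suc) (m+n≡0⇒n≡0 (g zero) ∑≡0) i

∑-indicator : ∀ {n} (g : Fin n → ℕ) j → ∑[ i < n ] (𝟙[ i Fin.≟ j ] * g i) ≡ g j
∑-indicator {suc n} g zero    = begin-equality
  1 * g zero + ∑[ i < n ] 0 ≡⟨ cong₂ _+_ (*-identityˡ (g zero)) (sum-replicate-zero n) ⟩
  g zero + 0                ≡⟨ +-identityʳ (g zero) ⟩
  g zero                    ∎
∑-indicator {suc n} g (suc j) = trans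
  (sum-cong-≗ {n} λ i → cong (_* g (suc i)) (𝟙-cong (suc i Fin.≟ suc j) (i Fin.≟ j) Fin.suc-injective (cong suc)))
  (∑-indicator (g ∘ suc) j)

∑-select : ∀ {n} {u : Fin n → ℕ} {j} → (∀ i → u i ≡ 𝟙[ i Fin.≟ j ]) → ∀ g → ∑[ i < n ] (u i * g i) ≡ g j
∑-select {n} {u} {j} u≡𝟙 g = trans (sum-cong-≗ {n} λ i → cong (_* g i) (u≡𝟙 i)) (∑-indicator g j)

∑≡1⇒indicator : ∀ {n} (u : Fin n → ℕ) → ∑[ i < n ] u i ≡ 1 → ∃ λ j → ∀ i → u i ≡ 𝟙[ i Fin.≟ j ]
∑≡1⇒indicator {suc n} u ∑≡1 with u zero in u₀≡
... | 0 with ∑≡1⇒indicator (u ∘ suc) ∑≡1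
...   | j , u≡ = suc j , λ { zero → u₀≡ ; (suc i) → trans (u≡ i)
                                 (𝟙-cong (i Fin.≟ j) (suc i Fin.≟ suc j) (cong suc) Fin.suc-injective) }
∑≡1⇒indicator {suc n} u ∑≡1 | 1 =
  zero , λ { zero → u₀≡ ; (suc i) → ∑≡0⇒≡0 (u ∘ suc) (suc-injective ∑≡1) i }
∑≡1⇒indicator {suc n} u ∑≡1 | suc (suc _) = case ∑≡1 of λ ()

∑-toℕ-indicator : ∀ {N x} → x < N → ∑[ v < N ] 𝟙[ toℕ v ≟ x ] ≡ 1
∑-toℕ-indicator {suc N} {zero}  _         = cong suc (sum-replicate-zero N)
∑-toℕ-indicator {suc N} {suc x} (s≤s x<N) = trans
  (sum-cong-≗ {N} λ v → 𝟙-cong (suc (toℕ v) ≟ suc x) (toℕ v ≟ x) suc-injective (cong suc))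
  (∑-toℕ-indicator x<N)

sum-tabulate : ∀ {n} (g : Fin n → ℕ) → sumₗ (tabulate g) ≡ ∑[ i < n ] g i
sum-tabulate {zero}  g = refl
sum-tabulate {suc n} g = cong (g zero +_) (sum-tabulate (g ∘ suc))

sum-map-allFin : ∀ {n} (g : Fin n → ℕ) → sumₗ (map g (allFin n)) ≡ ∑[ i < n ] g i
sum-map-allFin g = trans (cong sumₗ (map-tabulate (λ i → i) g)) (sum-tabulate g)

sum-map-filter : ∀ {a p} {A : Set a} {P : A → Set p} (P? : Decidable P) (g : A → ℕ) xs →
  sumₗ (map g (filter P? xs)) ≡ sumₗ (map (λ x → g x * 𝟙[ P? x ]) xs)
sum-map-filter P? g []       = refl
sum-map-filter P? g (x ∷ xs) with P? x
... | yes _ rewrite *-identityʳ (g x) = cong (g x +_) (sum-map-filter P? g xs)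
... | no  _ rewrite *-zeroʳ (g x)     = sum-map-filter P? g xs

length-filter : ∀ {a p} {A : Set a} {P : A → Set p} (P? : Decidable P) xs →
  length (filter P? xs) ≡ sumₗ (map (λ x → 𝟙[ P? x ]) xs)
length-filter P? []       = refl
length-filter P? (x ∷ xs) with P? x
... | yes _ = cong suc (length-filter P? xs)
... | no  _ = length-filter P? xs

-- Multiplicities in multisets of naturals

multiplicity : ℕ → List ℕ → ℕ
multiplicity v xs = sumₗ (map (λ x → 𝟙[ v ≟ x ]) xs)

multiplicity-removeOne : ∀ v y xs → multiplicity v (removeOne y xs) ≡ multiplicity v xs ∸ 𝟙[ v ≟ y ]
multiplicity-removeOne v y []       = sym (0∸n≡0 𝟙[ v ≟ y ])
multiplicity-removeOne v y (x ∷ xs) with y ≟ x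
... | yes refl = sym (m+n∸m≡n 𝟙[ v ≟ y ] _)
... | no  y≢x rewrite multiplicity-removeOne v y xs with v ≟ y
...   | yes refl rewrite 𝟙-no (v ≟ x) y≢x = refl
...   | no  _    = refl

multiplicity-∖ₘ : ∀ v xs ys → multiplicity v (xs ∖ₘ ys) ≡ multiplicity v xs ∸ multiplicity v ys
multiplicity-∖ₘ v xs []       = refl
multiplicity-∖ₘ v xs (y ∷ ys) = begin-equality
  multiplicity v (removeOne y xs ∖ₘ ys)                   ≡⟨ multiplicity-∖ₘ v (removeOne y xs) ys ⟩
  multiplicity v (removeOne y xs) ∸ multiplicity v ys     ≡⟨ cong (_∸ multiplicity v ys) (multiplicity-removeOne v y xs) ⟩
  multiplicity v xs ∸ 𝟙[ v ≟ y ] ∸ multiplicity v ys      ≡⟨ ∸-+-assoc (multiplicity v xs) 𝟙[ v ≟ y ] (multiplicity v ys) ⟩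
  multiplicity v xs ∸ multiplicity v (y ∷ ys)             ∎

elem⇒0<multiplicity : ∀ x ys → elem x ys ≡ true → 0 < multiplicity x ys
elem⇒0<multiplicity x (y ∷ ys) x∈ with x ≟ y
... | yes _ = s≤s z≤n
... | no  _ = ≤-trans (elem⇒0<multiplicity x ys x∈) (m≤n+m _ _)

¬elem⇒multiplicity≡0 : ∀ x ys → elem x ys ≡ false → multiplicity x ys ≡ 0
¬elem⇒multiplicity≡0 x []       _  = refl
¬elem⇒multiplicity≡0 x (y ∷ ys) x∉ with x ≟ y
... | no  _ = ¬elem⇒multiplicity≡0 x ys x∉

multiplicity-∩ₘ : ∀ v xs ys → multiplicity v (xs ∩ₘ ys) ≡ multiplicity v xs ⊓ multiplicity v ys
multiplicity-∩ₘ v []       ys = refl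
multiplicity-∩ₘ v (x ∷ xs) ys with elem x ys in x∈ys
... | true  = begin-equality
  𝟙[ v ≟ x ] + multiplicity v (xs ∩ₘ removeOne x ys)
    ≡⟨ cong (𝟙[ v ≟ x ] +_) (multiplicity-∩ₘ v xs (removeOne x ys)) ⟩
  𝟙[ v ≟ x ] + (multiplicity v xs ⊓ multiplicity v (removeOne x ys))
    ≡⟨ cong (λ n → 𝟙[ v ≟ x ] + (multiplicity v xs ⊓ n)) (multiplicity-removeOne v x ys) ⟩
  𝟙[ v ≟ x ] + (multiplicity v xs ⊓ (multiplicity v ys ∸ 𝟙[ v ≟ x ]))
    ≡⟨ +-distribˡ-⊓ 𝟙[ v ≟ x ] _ _ ⟩
  (𝟙[ v ≟ x ] + multiplicity v xs) ⊓ (𝟙[ v ≟ x ] + (multiplicity v ys ∸ 𝟙[ v ≟ x ]))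
    ≡⟨ cong ((𝟙[ v ≟ x ] + multiplicity v xs) ⊓_) (m+[n∸m]≡n 𝟙≤multiplicity) ⟩
  (𝟙[ v ≟ x ] + multiplicity v xs) ⊓ multiplicity v ys ∎
  where
  𝟙≤multiplicity : 𝟙[ v ≟ x ] ≤ multiplicity v ys
  𝟙≤multiplicity with v ≟ x
  ... | yes refl = elem⇒0<multiplicity v ys x∈ys
  ... | no  _    = z≤n
... | false = trans (multiplicity-∩ₘ v xs ys) absorb
  where
  absorb : multiplicity v xs ⊓ multiplicity v ys ≡ (𝟙[ v ≟ x ] + multiplicity v xs) ⊓ multiplicity v ys
  absorb with v ≟ x
  ... | yes refl rewrite ¬elem⇒multiplicity≡0 v ys x∈ys = ⊓-zeroʳ (multiplicity v xs)
  ... | no  _    = refl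

All-removeOne : ∀ {N} y xs → All (_< N) xs → All (_< N) (removeOne y xs)
All-removeOne y []       []         = []
All-removeOne y (x ∷ xs) (x<N ∷ xs<N) with y ≟ x
... | yes _ = xs<N
... | no  _ = x<N ∷ All-removeOne y xs xs<N

All-∩ₘ : ∀ {N} xs ys → All (_< N) xs → All (_< N) (xs ∩ₘ ys)
All-∩ₘ []       ys []           = []
All-∩ₘ (x ∷ xs) ys (x<N ∷ xs<N) with elem x ys
... | true  = x<N ∷ All-∩ₘ xs (removeOne x ys) xs<N
... | false = All-∩ₘ xs ys xs<N

All-∖ₘ : ∀ {N} xs ys → All (_< N) xs → All (_< N) (xs ∖ₘ ys)
All-∖ₘ xs []       xs<N = xs<N
All-∖ₘ xs (y ∷ ys) xs<N = All-∖ₘ (removeOne y xs) ys (All-removeOne y xs xs<N)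

length≡∑multiplicity : ∀ {N} xs → All (_< N) xs → length xs ≡ ∑[ v < N ] multiplicity (toℕ v) xs
length≡∑multiplicity {N} []       []           = sym (sum-replicate-zero N)
length≡∑multiplicity {N} (x ∷ xs) (x<N ∷ xs<N) = sym (begin-equality
  ∑[ v < N ] (𝟙[ toℕ v ≟ x ] + multiplicity (toℕ v) xs)
    ≡⟨ ∑-distrib-+ {N} (λ v → 𝟙[ toℕ v ≟ x ]) (λ v → multiplicity (toℕ v) xs) ⟩
  ∑[ v < N ] 𝟙[ toℕ v ≟ x ] + ∑[ v < N ] multiplicity (toℕ v) xs
    ≡⟨ cong₂ _+_ (∑-toℕ-indicator x<N) (sym (length≡∑multiplicity xs xs<N)) ⟩
  suc (length xs) ∎)

length-∩ₘ : ∀ {N} xs ys → All (_< N) xs →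
  length (xs ∩ₘ ys) ≡ ∑[ v < N ] (multiplicity (toℕ v) xs ⊓ multiplicity (toℕ v) ys)
length-∩ₘ {N} xs ys xs<N = trans (length≡∑multiplicity (xs ∩ₘ ys) (All-∩ₘ xs ys xs<N))
                                 (sum-cong-≗ {N} λ v → multiplicity-∩ₘ (toℕ v) xs ys)

length-∖ₘ : ∀ {N} xs ys → All (_< N) xs →
  length (xs ∖ₘ ys) ≡ ∑[ v < N ] (multiplicity (toℕ v) xs ∸ multiplicity (toℕ v) ys)
length-∖ₘ {N} xs ys xs<N = trans (length≡∑multiplicity (xs ∖ₘ ys) (All-∖ₘ xs ys xs<N))
                                 (sum-cong-≗ {N} λ v → multiplicity-∖ₘ (toℕ v) xs ys)

module _ {N : ℕ} {xs ys : List ℕ} (xs<N : All (_< N) xs) where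

  private
    m₁ m₂ : Fin N → ℕ
    m₁ v = multiplicity (toℕ v) xs
    m₂ v = multiplicity (toℕ v) ys

  length≡∩ₘ+∖ₘ : length xs ≡ length (xs ∩ₘ ys) + length (xs ∖ₘ ys)
  length≡∩ₘ+∖ₘ = begin-equality
    length xs                                            ≡⟨ length≡∑multiplicity xs xs<N ⟩
    ∑[ v < N ] m₁ v                                      ≡⟨ sum-cong-≗ {N} split ⟨
    ∑[ v < N ] (m₁ v ⊓ m₂ v + (m₁ v ∸ m₂ v))             ≡⟨ ∑-distrib-+ {N} (λ v → m₁ v ⊓ m₂ v) (λ v → m₁ v ∸ m₂ v) ⟩
    ∑[ v < N ] (m₁ v ⊓ m₂ v) + ∑[ v < N ] (m₁ v ∸ m₂ v)  ≡⟨ cong₂ _+_ (length-∩ₘ xs ys xs<N) (length-∖ₘ xs ys xs<N) ⟨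
    length (xs ∩ₘ ys) + length (xs ∖ₘ ys)                ∎
    where
    split : ∀ v → m₁ v ⊓ m₂ v + (m₁ v ∸ m₂ v) ≡ m₁ v
    split v = trans (cong (_+ (m₁ v ∸ m₂ v)) (⊓-comm (m₁ v) (m₂ v))) (m⊓n+n∸m≡n (m₂ v) (m₁ v))

  length≡∩ₘ+∖ₘ′ : All (_< N) ys → length ys ≡ length (xs ∩ₘ ys) + length (ys ∖ₘ xs)
  length≡∩ₘ+∖ₘ′ ys<N = begin-equality
    length ys                                            ≡⟨ length≡∑multiplicity ys ys<N ⟩
    ∑[ v < N ] m₂ v                                      ≡⟨ sum-cong-≗ {N} (λ v → m⊓n+n∸m≡n (m₁ v) (m₂ v)) ⟨
    ∑[ v < N ] (m₁ v ⊓ m₂ v + (m₂ v ∸ m₁ v))             ≡⟨ ∑-distrib-+ {N} (λ v → m₁ v ⊓ m₂ v) (λ v → m₂ v ∸ m₁ v) ⟩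
    ∑[ v < N ] (m₁ v ⊓ m₂ v) + ∑[ v < N ] (m₂ v ∸ m₁ v)  ≡⟨ cong₂ _+_ (length-∩ₘ xs ys xs<N) (length-∖ₘ ys xs ys<N) ⟨
    length (xs ∩ₘ ys) + length (ys ∖ₘ xs)                ∎

-- Top-cuts and walks

module _ (G : STDAG) where
  open STDAG G

  Cut? : (i : Vertex) (a : Fin m) → Dec (toℕ (tl a) ≤ toℕ i × toℕ i < toℕ (hd a))
  Cut? i a = (toℕ (tl a) ≤? toℕ i) ×-dec (toℕ i <? toℕ (hd a))

  cutValues : (Fin m → ℕ) → Vertex → List ℕ
  cutValues f i = flowValues G f (topCut G i)

  length-topCut : ∀ i → length (topCut G i) ≡ ∑[ a < m ] 𝟙[ Cut? i a ]
  length-topCut i = trans (length-filter (Cut? i) (allFin m)) (sum-map-allFin (λ a → 𝟙[ Cut? i a ]))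

  multiplicity-cutValues : ∀ f i v → multiplicity v (cutValues f i) ≡ ∑[ a < m ] (𝟙[ v ≟ f a ] * 𝟙[ Cut? i a ])
  multiplicity-cutValues f i v = begin-equality
    sumₗ (map (λ x → 𝟙[ v ≟ x ]) (map f (topCut G i)))             ≡⟨ cong sumₗ (map-∘ (topCut G i)) ⟨
    sumₗ (map (λ a → 𝟙[ v ≟ f a ]) (topCut G i))                   ≡⟨ sum-map-filter (Cut? i) (λ a → 𝟙[ v ≟ f a ]) (allFin m) ⟩
    sumₗ (map (λ a → 𝟙[ v ≟ f a ] * 𝟙[ Cut? i a ]) (allFin m))     ≡⟨ sum-map-allFin (λ a → 𝟙[ v ≟ f a ] * 𝟙[ Cut? i a ]) ⟩
    ∑[ a < m ] (𝟙[ v ≟ f a ] * 𝟙[ Cut? i a ])                       ∎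

  crossings : ∀ {u v} → Vertex → Walk G u v → ℕ
  crossings i p = ∑[ a < m ] (uses G a p * 𝟙[ Cut? i a ])

  crossings-cons : ∀ {v} i b (p : Walk G (hd b) v) → crossings i (cons b p) ≡ 𝟙[ Cut? i b ] + crossings i p
  crossings-cons i b p = begin-equality
    ∑[ a < m ] ((𝟙[ a Fin.≟ b ] + uses G a p) * 𝟙[ Cut? i a ])
      ≡⟨ sum-cong-≗ {m} (λ a → *-distribʳ-+ 𝟙[ Cut? i a ] 𝟙[ a Fin.≟ b ] (uses G a p)) ⟩
    ∑[ a < m ] (𝟙[ a Fin.≟ b ] * 𝟙[ Cut? i a ] + uses G a p * 𝟙[ Cut? i a ])
      ≡⟨ ∑-distrib-+ {m} (λ a → 𝟙[ a Fin.≟ b ] * 𝟙[ Cut? i a ]) (λ a → uses G a p * 𝟙[ Cut? i a ]) ⟩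
    ∑[ a < m ] (𝟙[ a Fin.≟ b ] * 𝟙[ Cut? i a ]) + crossings i p
      ≡⟨ cong (_+ crossings i p) (∑-indicator (λ a → 𝟙[ Cut? i a ]) b) ⟩
    𝟙[ Cut? i b ] + crossings i p ∎

  crossings-beyond : ∀ {u v} i (p : Walk G u v) → toℕ i < toℕ u → crossings i p ≡ 0
  crossings-beyond i nil        _    = sum-replicate-zero m
  crossings-beyond i (cons b p) i<tl = begin-equality
    crossings i (cons b p)         ≡⟨ crossings-cons i b p ⟩
    𝟙[ Cut? i b ] + crossings i p  ≡⟨ cong₂ _+_ (𝟙-no (Cut? i b) (λ (tl≤i , _) → <⇒≱ i<tl tl≤i))
                                               (crossings-beyond i p (<-trans i<tl (topo b))) ⟩
    0                              ∎

  crossings≤1 : ∀ {u v} i (p : Walk G u v) → crossings i p ≤ 1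
  crossings≤1 i nil = ≤-trans (≤-reflexive (sum-replicate-zero m)) z≤n
  crossings≤1 i (cons b p) rewrite crossings-cons i b p with Cut? i b
  ... | yes (_ , i<hd) rewrite crossings-beyond i p i<hd = ≤-refl
  ... | no  _                                           = crossings≤1 i p

-- Flow decompositions

module Decomposition (G : STDAG) (f : Fin (STDAG.m G) → ℕ) (flow : IsFlow G f)
                     {k : ℕ} (D : FlowDecomposition G f k) where
  open STDAG G
  open IsFlow flow using (positive)
  open FlowDecomposition D

  onPath : Fin m → Fin k → ℕ
  onPath a j = uses G a (path j)

  pathCount : Fin m → ℕ
  pathCount a = ∑[ j < k ] onPath a j

  f≡∑onPath*weight : ∀ a → f a ≡ ∑[ j < k ] (onPath a j * weight j)
  f≡∑onPath*weight a =
    trans (decomposes a) (trans (sum-tabulate (λ j → weight j * onPath a j)) (sum-cong-≗ {k} λ j → *-comm (weight j) (onPath a j)))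

  pathCount-positive : ∀ a → 0 < pathCount a
  pathCount-positive a = n≢0⇒n>0 λ noPath → <⇒≢ (positive a) (sym (begin-equality
    f a                                  ≡⟨ f≡∑onPath*weight a ⟩
    ∑[ j < k ] (onPath a j * weight j)   ≡⟨ sum-cong-≗ {k} (λ j → cong (_* weight j) (∑≡0⇒≡0 (onPath a) noPath j)) ⟩
    ∑[ j < k ] 0                         ≡⟨ sum-replicate-zero k ⟩
    0                                    ∎))

  single : Fin m → ℕ
  single a = 𝟙[ pathCount a ≟ 1 ]

  2≤pathCount+single : ∀ a → 2 ≤ pathCount a + single a
  2≤pathCount+single a with pathCount a ≟ 1
  ... | yes one = ≤-reflexive (cong (_+ 1) (sym one))
  ... | no  ¬one = ≤-trans (≤∧≢⇒< (pathCount-positive a) (¬one ∘ sym)) (m≤m+n (pathCount a) 0)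

  pathCount*single : ∀ a → pathCount a * single a ≡ single a
  pathCount*single a with pathCount a ≟ 1
  ... | yes one = trans (*-identityʳ (pathCount a)) one
  ... | no  _   = *-zeroʳ (pathCount a)

  -- The unique path through a single arc a carries weight f a.
  single-weight : ∀ a v → single a * ∑[ j < k ] (onPath a j * 𝟙[ v ≟ weight j ]) ≤ 𝟙[ v ≟ f a ]
  single-weight a v with pathCount a ≟ 1
  ... | no  _   = z≤n
  ... | yes one with ∑≡1⇒indicator (onPath a) one
  ...   | j , onPath≡𝟙 = ≤-reflexive (begin-equality
    1 * ∑[ j′ < k ] (onPath a j′ * 𝟙[ v ≟ weight j′ ])  ≡⟨ *-identityˡ _ ⟩
    ∑[ j′ < k ] (onPath a j′ * 𝟙[ v ≟ weight j′ ])      ≡⟨ ∑-select onPath≡𝟙 (λ j′ → 𝟙[ v ≟ weight j′ ]) ⟩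
    𝟙[ v ≟ weight j ]                                   ≡⟨ cong (λ x → 𝟙[ v ≟ x ]) (∑-select onPath≡𝟙 weight) ⟨
    𝟙[ v ≟ ∑[ j′ < k ] (onPath a j′ * weight j′) ]      ≡⟨ cong (λ x → 𝟙[ v ≟ x ]) (f≡∑onPath*weight a) ⟨
    𝟙[ v ≟ f a ]                                        ∎)

  singleCrossings : Vertex → Fin k → ℕ
  singleCrossings i j = ∑[ a < m ] (onPath a j * (single a * 𝟙[ Cut? G i a ]))

  singleCrossings≤1 : ∀ i j → singleCrossings i j ≤ 1
  singleCrossings≤1 i j = ≤-trans
    (∑-mono-≤ λ a → *-monoʳ-≤ (onPath a j) (*-monoˡ-≤1 𝟙[ Cut? G i a ] (𝟙≤1 (pathCount a ≟ 1))))
    (crossings≤1 G i (path j))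

  ∑-pathCount-cut≤k : ∀ i → ∑[ a < m ] (pathCount a * 𝟙[ Cut? G i a ]) ≤ k
  ∑-pathCount-cut≤k i = begin
    ∑[ a < m ] (pathCount a * 𝟙[ Cut? G i a ])            ≡⟨ sum-cong-≗ {m} (λ a → *-distribʳ-sum 𝟙[ Cut? G i a ] (onPath a)) ⟩
    ∑[ a < m ] ∑[ j < k ] (onPath a j * 𝟙[ Cut? G i a ])  ≡⟨ ∑-comm (λ a j → onPath a j * 𝟙[ Cut? G i a ]) ⟩
    ∑[ j < k ] crossings G i (path j)                      ≤⟨ ∑≤card _ (λ j → crossings≤1 G i (path j)) ⟩
    k                                                      ∎

  ∑-single-cut≡∑singleCrossings : ∀ i → ∑[ a < m ] (single a * 𝟙[ Cut? G i a ]) ≡ ∑[ j < k ] singleCrossings i j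
  ∑-single-cut≡∑singleCrossings i = begin-equality
    ∑[ a < m ] (single a * 𝟙[ Cut? G i a ])
      ≡⟨ sum-cong-≗ {m} (λ a → trans (sym (*-assoc (pathCount a) (single a) _)) (cong (_* 𝟙[ Cut? G i a ]) (pathCount*single a))) ⟨
    ∑[ a < m ] (pathCount a * (single a * 𝟙[ Cut? G i a ]))
      ≡⟨ sum-cong-≗ {m} (λ a → *-distribʳ-sum (single a * 𝟙[ Cut? G i a ]) (onPath a)) ⟩
    ∑[ a < m ] ∑[ j < k ] (onPath a j * (single a * 𝟙[ Cut? G i a ]))
      ≡⟨ ∑-comm (λ a j → onPath a j * (single a * 𝟙[ Cut? G i a ])) ⟩
    ∑[ j < k ] singleCrossings i j ∎

  twice-length-topCut : ∀ i → 2 * length (topCut G i) ≤ k + ∑[ j < k ] singleCrossings i j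
  twice-length-topCut i = begin
    2 * length (topCut G i)                          ≡⟨ cong (2 *_) (length-topCut G i) ⟩
    2 * ∑[ a < m ] 𝟙[ Cut? G i a ]                   ≡⟨ *-distribˡ-sum 2 (λ a → 𝟙[ Cut? G i a ]) ⟩
    ∑[ a < m ] (2 * 𝟙[ Cut? G i a ])                 ≤⟨ ∑-mono-≤ (λ a → *-monoˡ-≤ 𝟙[ Cut? G i a ] (2≤pathCount+single a)) ⟩
    ∑[ a < m ] ((pathCount a + single a) * 𝟙[ Cut? G i a ])
      ≡⟨ sum-cong-≗ {m} (λ a → *-distribʳ-+ 𝟙[ Cut? G i a ] (pathCount a) (single a)) ⟩
    ∑[ a < m ] (pathCount a * 𝟙[ Cut? G i a ] + single a * 𝟙[ Cut? G i a ])
      ≡⟨ ∑-distrib-+ {m} (λ a → pathCount a * 𝟙[ Cut? G i a ]) (λ a → single a * 𝟙[ Cut? G i a ]) ⟩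
    ∑[ a < m ] (pathCount a * 𝟙[ Cut? G i a ]) + ∑[ a < m ] (single a * 𝟙[ Cut? G i a ])
      ≤⟨ +-mono-≤ (∑-pathCount-cut≤k i) (≤-reflexive (∑-single-cut≡∑singleCrossings i)) ⟩
    k + ∑[ j < k ] singleCrossings i j ∎

  twice-two-cuts : ∀ i₁ i₂ → 2 * length (topCut G i₁) + 2 * length (topCut G i₂)
                             ≤ 3 * k + ∑[ j < k ] (singleCrossings i₁ j * singleCrossings i₂ j)
  twice-two-cuts i₁ i₂ = begin
    2 * length (topCut G i₁) + 2 * length (topCut G i₂)
      ≤⟨ +-mono-≤ (twice-length-topCut i₁) (twice-length-topCut i₂) ⟩
    (k + ∑[ j < k ] X₁ j) + (k + ∑[ j < k ] X₂ j)
      ≡⟨ regroup k (∑[ j < k ] X₁ j) (∑[ j < k ] X₂ j) ⟩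
    2 * k + (∑[ j < k ] X₁ j + ∑[ j < k ] X₂ j)
      ≡⟨ cong (2 * k +_) (∑-distrib-+ {k} X₁ X₂) ⟨
    2 * k + ∑[ j < k ] (X₁ j + X₂ j)
      ≤⟨ +-monoʳ-≤ (2 * k) (∑-mono-≤ λ j → m+n≤1+m*n (singleCrossings≤1 i₁ j) (singleCrossings≤1 i₂ j)) ⟩
    2 * k + ∑[ j < k ] (1 + X₁ j * X₂ j)
      ≡⟨ cong (2 * k +_) (∑-distrib-+ {k} (λ _ → 1) (λ j → X₁ j * X₂ j)) ⟩
    2 * k + (∑[ j < k ] 1 + ∑[ j < k ] (X₁ j * X₂ j))
      ≤⟨ +-monoʳ-≤ (2 * k) (+-monoˡ-≤ (∑[ j < k ] (X₁ j * X₂ j)) (∑≤card (λ _ → 1) (λ _ → ≤-refl))) ⟩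
    2 * k + (k + ∑[ j < k ] (X₁ j * X₂ j))
      ≡⟨ absorb k (∑[ j < k ] (X₁ j * X₂ j)) ⟩
    3 * k + ∑[ j < k ] (X₁ j * X₂ j) ∎
    where
    X₁ X₂ : Fin k → ℕ
    X₁ = singleCrossings i₁
    X₂ = singleCrossings i₂
    regroup : ∀ k a b → (k + a) + (k + b) ≡ 2 * k + (a + b)
    regroup = solve-∀
    absorb : ∀ k a → 2 * k + (k + a) ≡ 3 * k + a
    absorb = solve-∀

  singleCrossings-weight≤multiplicity : ∀ i v →
    ∑[ j < k ] (singleCrossings i j * 𝟙[ v ≟ weight j ]) ≤ multiplicity v (cutValues G f i)
  singleCrossings-weight≤multiplicity i v = begin
    ∑[ j < k ] (singleCrossings i j * δ j)
      ≡⟨ sum-cong-≗ {k} (λ j → *-distribʳ-sum (δ j) (λ a → onPath a j * (single a * c a))) ⟩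
    ∑[ j < k ] ∑[ a < m ] (onPath a j * (single a * c a) * δ j)
      ≡⟨ ∑-comm (λ j a → onPath a j * (single a * c a) * δ j) ⟩
    ∑[ a < m ] ∑[ j < k ] (onPath a j * (single a * c a) * δ j)
      ≡⟨ sum-cong-≗ {m} pull-out ⟩
    ∑[ a < m ] (single a * ∑[ j < k ] (onPath a j * δ j) * c a)
      ≤⟨ ∑-mono-≤ (λ a → *-monoˡ-≤ (c a) (single-weight a v)) ⟩
    ∑[ a < m ] (𝟙[ v ≟ f a ] * c a)
      ≡⟨ multiplicity-cutValues G f i v ⟨
    multiplicity v (cutValues G f i) ∎
    where
    δ : Fin k → ℕ
    δ j = 𝟙[ v ≟ weight j ]
    c : Fin m → ℕ
    c a = 𝟙[ Cut? G i a ]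
    pull-out : ∀ a → ∑[ j < k ] (onPath a j * (single a * c a) * δ j) ≡ single a * ∑[ j < k ] (onPath a j * δ j) * c a
    pull-out a = begin-equality
      ∑[ j < k ] (onPath a j * (single a * c a) * δ j)
        ≡⟨ sum-cong-≗ {k} (λ j → swap (onPath a j) (single a) (c a) (δ j)) ⟩
      ∑[ j < k ] (single a * c a * (onPath a j * δ j))
        ≡⟨ *-distribˡ-sum (single a * c a) (λ j → onPath a j * δ j) ⟨
      single a * c a * ∑[ j < k ] (onPath a j * δ j)
        ≡⟨ swap′ (single a) (c a) _ ⟩
      single a * ∑[ j < k ] (onPath a j * δ j) * c a ∎
      where
      swap : ∀ x s c d → x * (s * c) * d ≡ s * c * (x * d)
      swap = solve-∀
      swap′ : ∀ s c y → s * c * y ≡ s * y * c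
      swap′ = solve-∀

  ∑-shared≤∑min : ∀ {N} → (∀ j → weight j < N) → ∀ i₁ i₂ →
    ∑[ j < k ] (singleCrossings i₁ j * singleCrossings i₂ j)
      ≤ ∑[ v < N ] (multiplicity (toℕ v) (cutValues G f i₁) ⊓ multiplicity (toℕ v) (cutValues G f i₂))
  ∑-shared≤∑min {N} w<N i₁ i₂ = begin
    ∑[ j < k ] (X₁ j * X₂ j)
      ≡⟨ sum-cong-≗ {k} spread ⟩
    ∑[ j < k ] ∑[ v < N ] (X₁ j * X₂ j * δ v j)
      ≡⟨ ∑-comm (λ j v → X₁ j * X₂ j * δ v j) ⟩
    ∑[ v < N ] ∑[ j < k ] (X₁ j * X₂ j * δ v j)
      ≤⟨ ∑-mono-≤ (λ v → ⊓-glb (bound₁ v) (bound₂ v)) ⟩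
    ∑[ v < N ] (multiplicity (toℕ v) (cutValues G f i₁) ⊓ multiplicity (toℕ v) (cutValues G f i₂)) ∎
    where
    X₁ X₂ : Fin k → ℕ
    X₁ = singleCrossings i₁
    X₂ = singleCrossings i₂
    δ : Fin N → Fin k → ℕ
    δ v j = 𝟙[ toℕ v ≟ weight j ]
    spread : ∀ j → X₁ j * X₂ j ≡ ∑[ v < N ] (X₁ j * X₂ j * δ v j)
    spread j = begin-equality
      X₁ j * X₂ j                               ≡⟨ *-identityʳ (X₁ j * X₂ j) ⟨
      X₁ j * X₂ j * 1                           ≡⟨ cong (X₁ j * X₂ j *_) (∑-toℕ-indicator (w<N j)) ⟨
      X₁ j * X₂ j * ∑[ v < N ] δ v j            ≡⟨ *-distribˡ-sum (X₁ j * X₂ j) (λ v → δ v j) ⟩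
      ∑[ v < N ] (X₁ j * X₂ j * δ v j)          ∎
    bound₁ : ∀ v → ∑[ j < k ] (X₁ j * X₂ j * δ v j) ≤ multiplicity (toℕ v) (cutValues G f i₁)
    bound₁ v = ≤-trans (∑-mono-≤ λ j → *-monoˡ-≤ (δ v j) (*-monoʳ-≤1 (X₁ j) (singleCrossings≤1 i₂ j)))
                       (singleCrossings-weight≤multiplicity i₁ (toℕ v))
    bound₂ : ∀ v → ∑[ j < k ] (X₁ j * X₂ j * δ v j) ≤ multiplicity (toℕ v) (cutValues G f i₂)
    bound₂ v = ≤-trans (∑-mono-≤ λ j → *-monoˡ-≤ (δ v j) (*-monoˡ-≤1 (X₂ j) (singleCrossings≤1 i₁ j)))
                       (singleCrossings-weight≤multiplicity i₂ (toℕ v))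

-- Two top-cuts

2[I+a]+2[I+b]≤3k+I⇒3I+2[a+b]≤3k : ∀ I a b k → 2 * (I + a) + 2 * (I + b) ≤ 3 * k + I → 3 * I + 2 * (a + b) ≤ 3 * k
2[I+a]+2[I+b]≤3k+I⇒3I+2[a+b]≤3k I a b k le =
  +-cancelʳ-≤ I (3 * I + 2 * (a + b)) (3 * k) (≤-trans (≤-reflexive (regroup I a b)) le)
  where
  regroup : ∀ I a b → 3 * I + 2 * (a + b) + I ≡ 2 * (I + a) + 2 * (I + b)
  regroup = solve-∀

3[I+a]<3I+2[a+b]⇔a<2b : ∀ I a b → (3 * (I + a) < 3 * I + 2 * (a + b)) ⇔ (a < 2 * b)
3[I+a]<3I+2[a+b]⇔a<2b I a b = subst₂ (λ x y → (x < y) ⇔ (a < 2 * b)) (sym (lhs I a)) (sym (rhs I a b))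
  (mk⇔ (+-cancelˡ-< (3 * I + 2 * a) a (2 * b)) (+-monoʳ-< (3 * I + 2 * a)))
  where
  lhs : ∀ I a → 3 * (I + a) ≡ 3 * I + 2 * a + a
  lhs = solve-∀
  rhs : ∀ I a b → 3 * I + 2 * (a + b) ≡ 3 * I + 2 * a + 2 * b
  rhs = solve-∀

cutValues-bounded : ∀ G f {N} → (∀ a → f a < N) → ∀ i → All (_< N) (cutValues G f i)
cutValues-bounded G f f<N i = map⁺ (universal f<N (topCut G i))

module _ (G : STDAG) (f : Fin (STDAG.m G) → ℕ) (i₁ i₂ : STDAG.Vertex G) where
  open STDAG G using (m)

  private
    𝓕₁ 𝓕₂ : List ℕ
    𝓕₁ = cutValues G f i₁
    𝓕₂ = cutValues G f i₂

  length-topCut₁ : ∀ {N} → (∀ a → f a < N) → length (topCut G i₁) ≡ length (𝓕₁ ∩ₘ 𝓕₂) + length (𝓕₁ ∖ₘ 𝓕₂)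
  length-topCut₁ f<N = trans (sym (length-map f (topCut G i₁))) (length≡∩ₘ+∖ₘ (cutValues-bounded G f f<N i₁))

  length-topCut₂ : ∀ {N} → (∀ a → f a < N) → length (topCut G i₂) ≡ length (𝓕₁ ∩ₘ 𝓕₂) + length (𝓕₂ ∖ₘ 𝓕₁)
  length-topCut₂ f<N = trans (sym (length-map f (topCut G i₂)))
    (length≡∩ₘ+∖ₘ′ (cutValues-bounded G f f<N i₁) (cutValues-bounded G f f<N i₂))

  decomposition-size-bound : IsFlow G f → ∀ {k} → FlowDecomposition G f k →
    3 * length (𝓕₁ ∩ₘ 𝓕₂) + 2 * (length (𝓕₁ ∖ₘ 𝓕₂) + length (𝓕₂ ∖ₘ 𝓕₁)) ≤ 3 * k
  decomposition-size-bound flow {k} D = 2[I+a]+2[I+b]≤3k+I⇒3I+2[a+b]≤3k _ _ _ k (begin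
    2 * (length (𝓕₁ ∩ₘ 𝓕₂) + length (𝓕₁ ∖ₘ 𝓕₂)) + 2 * (length (𝓕₁ ∩ₘ 𝓕₂) + length (𝓕₂ ∖ₘ 𝓕₁))
      ≡⟨ cong₂ (λ x y → 2 * x + 2 * y) (length-topCut₁ f<N) (length-topCut₂ f<N) ⟨
    2 * length (topCut G i₁) + 2 * length (topCut G i₂)
      ≤⟨ twice-two-cuts i₁ i₂ ⟩
    3 * k + ∑[ j < k ] (singleCrossings i₁ j * singleCrossings i₂ j)
      ≤⟨ +-monoʳ-≤ (3 * k) (∑-shared≤∑min w<N i₁ i₂) ⟩
    3 * k + ∑[ v < N ] (multiplicity (toℕ v) 𝓕₁ ⊓ multiplicity (toℕ v) 𝓕₂)
      ≡⟨ cong (3 * k +_) (length-∩ₘ 𝓕₁ 𝓕₂ (cutValues-bounded G f f<N i₁)) ⟨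
    3 * k + length (𝓕₁ ∩ₘ 𝓕₂) ∎)
    where
    open Decomposition G f flow D
    open FlowDecomposition D using (weight)
    N : ℕ
    N = suc (∑[ a < m ] f a + ∑[ j < k ] weight j)
    f<N : ∀ a → f a < N
    f<N a = s≤s (≤-trans (≤-∑ f a) (m≤m+n _ _))
    w<N : ∀ j → weight j < N
    w<N j = s≤s (≤-trans (≤-∑ weight j) (m≤n+m _ _))

  bound-exceeds-cut⇔ : (3 * length (topCut G i₁) < 3 * length (𝓕₁ ∩ₘ 𝓕₂) + 2 * (length (𝓕₁ ∖ₘ 𝓕₂) + length (𝓕₂ ∖ₘ 𝓕₁)))
                        ⇔ (length (𝓕₁ ∖ₘ 𝓕₂) < 2 * length (𝓕₂ ∖ₘ 𝓕₁))
  bound-exceeds-cut⇔ rewrite length-topCut₁ (λ a → s≤s (≤-∑ f a)) =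
    3[I+a]<3I+2[a+b]⇔a<2b (length (𝓕₁ ∩ₘ 𝓕₂)) (length (𝓕₁ ∖ₘ 𝓕₂)) (length (𝓕₂ ∖ₘ 𝓕₁))

lemma5 : (G : STDAG) (f : Fin (STDAG.m G) → ℕ) → IsFlow G f →
    (i₁ i₂ : STDAG.Vertex G) →
    length (topCut G i₂) ≤ length (topCut G i₁) →
    let 𝓕₁ = flowValues G f (topCut G i₁)
        𝓕₂ = flowValues G f (topCut G i₂)
        I  = length (𝓕₁ ∩ₘ 𝓕₂)
        F₁ = length (𝓕₁ ∖ₘ 𝓕₂)
        F₂ = length (𝓕₂ ∖ₘ 𝓕₁)
    in ((k : ℕ) → FlowDecomposition G f k → 3 * I + 2 * (F₁ + F₂) ≤ 3 * k)
       × ((3 * length (topCut G i₁) < 3 * I + 2 * (F₁ + F₂)) ⇔ (F₁ < 2 * F₂))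
lemma5 G f flow i₁ i₂ _ = (λ _ → decomposition-size-bound G f i₁ i₂ flow) , bound-exceeds-cut⇔ G f i₁ i₂
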